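{- Let $G$ be a finite graph. Then $\alpha(H)=h(H)$ for every induced subgraph $H$ of $G$ if and only if $\omega(H)=\psi(H)$ for every induced subgraph $H$ of $G$.
   Context: All graphs are finite and simple. A $k$-coloring of $G$ is a surjective map $\varsigma\colon V(G)\to\{1,\dots,k\}$; it is proper if adjacent vertices get different colors, and complete if for every pair of distinct colors $i,j$ there is an edge $xy$ with $\varsigma(x)=i$, $\varsigma(y)=j$. $\omega(G)$ is the clique number. The Hadwiger number $h(G)$ is the largest $k$ such that $K_k$ is a minor of $G$ (obtained by deleting vertices, deleting edges and contracting edges). The pseudoachromatic number $\psi(G)$ is the largest $k$ for which $G$ has a complete $k$-coloring; the achromatic number $\alpha(G)$ is the largest $k$ for which $G$ has a proper complete $k$-coloring. For parameters $a,b$, $G$ is called $ab$-perfect if $a(H)=b(H)$ for all induced subgraphs $H$ of $G$; the claim says $G$ is $\alpha h$-perfect iff it is $\omega\psi$-perfect. -}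

module Defs where

open import Data.Nat using (ℕ; _≤_)
open import Data.Fin using (Fin)
open import Data.Bool using (Bool; true; false)
open import Data.Maybe using (Maybe; just)
open import Data.Product using (Σ; ∃; ∃-syntax; _×_; _,_)
open import Relation.Binary.PropositionalEquality using (_≡_; _≢_)
open import Function.Definitions using (Injective)

record Graph (n : ℕ) : Set where
  field
    adj    : Fin n → Fin n → Bool
    sym    : ∀ x y → adj x y ≡ adj y x
    irrefl : ∀ x → adj x x ≡ false
open Graph public

Adj : ∀ {n} → Graph n → Fin n → Fin n → Set
Adj G x y = adj G x y ≡ true

-- Induced subgraph on the image of an injection f : Fin m → Fin n
-- (every induced subgraph arises this way up to isomorphism).
induced : ∀ {m n} → Graph n → (Fin m → Fin n) → Graph m
induced G f = record
  { adj    = λ i j → adj G (f i) (f j)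
  ; sym    = λ i j → sym G (f i) (f j)
  ; irrefl = λ i → irrefl G (f i)
  }

Surjective : ∀ {n k} → (Fin n → Fin k) → Set
Surjective {n} {k} c = ∀ (i : Fin k) → ∃[ x ] c x ≡ i

Proper : ∀ {n k} → Graph n → (Fin n → Fin k) → Set
Proper G c = ∀ x y → Adj G x y → c x ≢ c y

Complete : ∀ {n k} → Graph n → (Fin n → Fin k) → Set
Complete {n} {k} G c =
  ∀ (i j : Fin k) → i ≢ j → ∃[ x ] ∃[ y ] (Adj G x y × c x ≡ i × c y ≡ j)

HasCompleteColoring : ∀ {n} → Graph n → ℕ → Set
HasCompleteColoring {n} G k =
  Σ (Fin n → Fin k) λ c → Surjective c × Complete G c

HasProperCompleteColoring : ∀ {n} → Graph n → ℕ → Set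
HasProperCompleteColoring {n} G k =
  Σ (Fin n → Fin k) λ c → Surjective c × Proper G c × Complete G c

HasClique : ∀ {n} → Graph n → ℕ → Set
HasClique {n} G k =
  Σ (Fin k → Fin n) λ f → Injective _≡_ _≡_ f × (∀ i j → i ≢ j → Adj G (f i) (f j))

data PathIn {n} (G : Graph n) (P : Fin n → Set) : Fin n → Fin n → Set where
  here : ∀ {x} → P x → PathIn G P x x
  step : ∀ {x y z} → P x → Adj G x y → PathIn G P y z → PathIn G P x z

-- Branch sets are encoded by a partial map b : V → Maybe (Fin k)
-- (V_i = b⁻¹(just i)), which makes them disjoint automatically.
HasCompleteMinor : ∀ {n} → Graph n → ℕ → Set
HasCompleteMinor {n} G k =
  Σ (Fin n → Maybe (Fin k)) λ b →
    (∀ (i : Fin k) → ∃[ x ] b x ≡ just i) ×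
    (∀ (i : Fin k) x y → b x ≡ just i → b y ≡ just i →
        PathIn G (λ z → b z ≡ just i) x y) ×
    (∀ (i j : Fin k) → i ≢ j →
        ∃[ x ] ∃[ y ] (Adj G x y × b x ≡ just i × b y ≡ just j))

IsLargest : (ℕ → Set) → ℕ → Set
IsLargest P k = P k × (∀ j → P j → j ≤ k)

SameValue : (ℕ → Set) → (ℕ → Set) → Set
SameValue P Q = ∃[ k ] (IsLargest P k × IsLargest Q k)

Perfect : ((∀ {m} → Graph m → ℕ → Set)) → (∀ {m} → Graph m → ℕ → Set) →
          ∀ {n} → Graph n → Set
Perfect A B {n} G =
  ∀ (m : ℕ) (f : Fin m → Fin n) → Injective _≡_ _≡_ f →
    SameValue (A (induced G f)) (B (induced G f))

-- α h-perfect: achromatic number = Hadwiger number on all induced subgraphs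
αh-Perfect : ∀ {n} → Graph n → Set
αh-Perfect = Perfect HasProperCompleteColoring HasCompleteMinor

-- ω ψ-perfect: clique number = pseudoachromatic number on all induced subgraphs
ωψ-Perfect : ∀ {n} → Graph n → Set
ωψ-Perfect = Perfect HasClique HasCompleteColoring

{-# OPTIONS --safe #-}
module Submission where

-- In every graph ω ≤ h ≤ ψ (a clique is a minor, a minor gives a complete colouring) and
-- ω ≤ α ≤ ψ (a proper colouring needs ω colours, and merging colour classes of a proper
-- colouring that see no edge between them produces a proper complete one).  Hence ω = ψ
-- forces α = h.  Conversely, α = h fails for induced P₄, P₃ ∪ K₂, 3K₂ (α = 3 > h) and
-- C₄ (h = 3 > α), and in a graph without these every complete k-colouring yields a
-- k-clique: universal and isolated vertices are removed inductively, and otherwise the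
-- closed neighbourhood N[v] of a vertex with ⊂-maximal N[v] and its complement are two
-- cliques with no edge between them, one of which must carry all colours.

open import Defs
open import Data.Nat using (ℕ)
open import Function.Bundles using (_⇔_)

open import Data.Bool as Bool using (Bool; true; false; _∨_)
open import Data.Bool.Properties using (∨-comm; ¬-not)
open import Data.Empty using (⊥; ⊥-elim)
open import Data.Fin using (Fin; zero; suc; #_; _<_; punchIn; punchOut; _↑ˡ_; splitAt)
open import Data.Fin.Properties
  using (_≟_; any?; all?; ¬∀⟶∃¬; <-cmp; punchInᵢ≢i; punchIn-injective; punchIn-punchOut;
         punchOut-punchIn; punchOut-cong′; punchOut-injective; injective⇒≤;
         ↑ˡ-injective; splitAt-↑ˡ; splitAt⁻¹-↑ˡ)
open import Data.Fin.Subset as Subset using (Subset; _⊆_; _⊂_; _⊃_)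
open import Data.Fin.Subset.Properties using (_⊂?_)
open import Data.Fin.Subset.Induction using (⊃-wellFounded)
open import Data.List as List using (List; []; _∷_; _++_; allFin)
open import Data.List.Membership.Propositional using (_∈_)
open import Data.List.Membership.Propositional.Properties using (∈-++⁺ˡ; ∈-++⁺ʳ; ∈-map⁺; ∈-allFin)
import Data.List.Membership.DecPropositional as DecMembership
open import Data.List.Relation.Unary.All as All using (All; []; _∷_)
open import Data.Maybe as Maybe using (Maybe; just; nothing; fromMaybe)
open import Data.Maybe.Properties using (just-injective) renaming (≡-dec to ≡-dec-Maybe)
open import Data.Nat using (zero; suc; _+_; _≤_; z≤n; s≤s)
open import Data.Nat.Properties using (≤-antisym; m≤n⇒∃[o]m+o≡n)
open import Data.Product as Product using (Σ; ∃; ∃-syntax; _×_; _,_; proj₁; proj₂; uncurry; map₂)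
open import Data.Product.Properties using () renaming (≡-dec to ×-≡-dec)
open import Data.Sum using (_⊎_; inj₁; inj₂; [_,_]′)
open import Data.Vec using (Vec; []; _∷_; lookup; tabulate)
open import Data.Vec.Properties using (lookup∘tabulate; []=⇒lookup; lookup⇒[]=)
open import Data.Vec.Functional as Vector using (Vector; head; tail)
open import Function using (_∘_; id; const)
open import Function.Bundles using (mk⇔)
open import Function.Definitions using (Injective)
open import Induction.WellFounded using (Acc; acc)
open import Relation.Nullary using (¬_; Dec; yes; no; does; contradiction)
open import Relation.Nullary.Decidable
  using (True; toWitness; from-yes; map′; _×-dec_; _⊎-dec_; _→-dec_; ¬?;
         decidable-stable; dec-true; dec-false; dec⇒maybe)
open import Relation.Binary using (tri<; tri≈; tri>)
open import Relation.Binary.PropositionalEquality as ≡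
  using (_≡_; _≢_; _≗_; refl; trans; cong; subst; ≢-sym)

module _ {n} (G : Graph n) where

  Adj? : ∀ x y → Dec (Adj G x y)
  Adj? x y = adj G x y Bool.≟ true

  Adj-sym : ∀ {x y} → Adj G x y → Adj G y x
  Adj-sym {x} {y} = trans (sym G y x)

  ¬Adj-sym : ∀ {x y} → ¬ Adj G x y → ¬ Adj G y x
  ¬Adj-sym ¬xy = ¬xy ∘ Adj-sym

  Adj⇒≢ : ∀ {x y} → Adj G x y → x ≢ y
  Adj⇒≢ {x} xx refl = contradiction (trans (≡.sym xx) (irrefl G x)) λ ()

SameAdj : ∀ {n} → Graph n → Graph n → Set
SameAdj {n} H H′ = ∀ (x y : Fin n) → adj H x y ≡ adj H′ x y

module Transport {m} (H H′ : Graph m) (same : SameAdj H H′) where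

  private
    to : ∀ {x y} → Adj H x y → Adj H′ x y
    to {x} {y} = trans (≡.sym (same x y))

    from : ∀ {x y} → Adj H′ x y → Adj H x y
    from {x} {y} = trans (same x y)

    path : ∀ {P x y} → PathIn H P x y → PathIn H′ P x y
    path (here px)         = here px
    path (step px xy rest) = step px (to xy) (path rest)

  properComplete : ∀ {k} → HasProperCompleteColoring H k → HasProperCompleteColoring H′ k
  properComplete (c , surj , proper , complete) =
    c , surj , (λ x y → proper x y ∘ from) ,
    λ i j i≢j → let x , y , xy , cx , cy = complete i j i≢j in x , y , to xy , cx , cy

  minor : ∀ {k} → HasCompleteMinor H k → HasCompleteMinor H′ k
  minor (branch , nonempty , connected , linked) =
    branch , nonempty , (λ i x y bx by → path (connected i x y bx by)) ,
    λ i j i≢j → let x , y , xy , bx , by = linked i j i≢j in x , y , to xy , bx , by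

-- Cliques, minors and complete colourings

module _ {m} (H : Graph m) where

  clique⇒minor : ∀ {k} → HasClique H k → HasCompleteMinor H k
  clique⇒minor {k} (q , q-inj , q-adj) = branch , (λ i → q i , branch-q i) , connected , linked
    where
    index? : ∀ x → Dec (∃ λ i → q i ≡ x)
    index? x = any? λ i → q i ≟ x

    branch : Fin m → Maybe (Fin k)
    branch x = Maybe.map proj₁ (dec⇒maybe (index? x))

    branch-q : ∀ i → branch (q i) ≡ just i
    branch-q i with index? (q i)
    ... | yes (_ , qi′≡qi) = cong just (q-inj qi′≡qi)
    ... | no ∄i            = contradiction (i , refl) ∄i

    q-branch : ∀ {x i} → branch x ≡ just i → q i ≡ x
    q-branch {x} bx with index? x
    q-branch refl | yes (_ , qi≡x) = qi≡x

    connected : ∀ i x y → branch x ≡ just i → branch y ≡ just i →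
                PathIn H (λ z → branch z ≡ just i) x y
    connected i x y bx by = subst (PathIn H _ x) (trans (≡.sym (q-branch bx)) (q-branch by)) (here bx)

    linked : ∀ i j → i ≢ j → ∃[ x ] ∃[ y ] (Adj H x y × branch x ≡ just i × branch y ≡ just j)
    linked i j i≢j = q i , q j , q-adj i j i≢j , branch-q i , branch-q j

  properComplete⇒complete : ∀ {k} → HasProperCompleteColoring H k → HasCompleteColoring H k
  properComplete⇒complete (c , surj , _ , complete) = c , surj , complete

  minor⇒complete : ∀ {k} → HasCompleteMinor H (suc k) → HasCompleteColoring H (suc k)
  minor⇒complete {k} (branch , nonempty , _ , linked) = colour , surj , complete
    where
    colour : Fin m → Fin (suc k)
    colour = fromMaybe zero ∘ branch

    surj : Surjective colour
    surj i = map₂ (cong (fromMaybe zero)) (nonempty i)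

    complete : Complete H colour
    complete i j i≢j = let x , y , xy , bx , by = linked i j i≢j in
      x , y , xy , cong (fromMaybe zero) bx , cong (fromMaybe zero) by

  clique≤colours : ∀ {k j} → HasClique H k → (c : Fin m → Fin j) → Proper H c → k ≤ j
  clique≤colours (q , _ , q-adj) c proper = injective⇒≤ c∘q-injective
    where
    c∘q-injective : Injective _≡_ _≡_ (c ∘ q)
    c∘q-injective {a} {b} same =
      decidable-stable (a ≟ b) λ a≢b → proper (q a) (q b) (q-adj a b a≢b) same

-- Colour i′ is merged into colour i; punchOut renumbers the remaining colours.
merge : ∀ {j} {i′ i : Fin (suc j)} → i′ ≢ i → Fin (suc j) → Fin j
merge {i′ = i′} i′≢i a with a ≟ i′
... | yes _   = punchOut i′≢i
... | no a≢i′ = punchOut (≢-sym a≢i′)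

module _ {j} {i′ i : Fin (suc j)} (i′≢i : i′ ≢ i) where

  merge-punchIn : ∀ s → merge i′≢i (punchIn i′ s) ≡ s
  merge-punchIn s with punchIn i′ s ≟ i′
  ... | yes eq = contradiction eq (punchInᵢ≢i i′ s)
  ... | no _   = trans (punchOut-cong′ i′ refl) (punchOut-punchIn i′)

  merge-≡ : ∀ {a b} → merge i′≢i a ≡ merge i′≢i b → a ≡ b ⊎ (a ≡ i′ × b ≡ i) ⊎ (a ≡ i × b ≡ i′)
  merge-≡ {a} {b} eq with a ≟ i′ | b ≟ i′
  ... | yes a≡i′ | yes b≡i′ = inj₁ (trans a≡i′ (≡.sym b≡i′))
  ... | yes a≡i′ | no b≢i′  = inj₂ (inj₁ (a≡i′ , ≡.sym (punchOut-injective i′≢i (≢-sym b≢i′) eq)))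
  ... | no a≢i′  | yes b≡i′ = inj₂ (inj₂ (punchOut-injective (≢-sym a≢i′) i′≢i eq , b≡i′))
  ... | no a≢i′  | no b≢i′  = inj₁ (punchOut-injective (≢-sym a≢i′) (≢-sym b≢i′) eq)

module _ {m} (H : Graph m) where

  ColoursMeet : ∀ {k} → (Fin m → Fin k) → Fin k → Fin k → Set
  ColoursMeet c i j = ∃[ x ] ∃[ y ] (Adj H x y × c x ≡ i × c y ≡ j)

  coloursMeet? : ∀ {k} (c : Fin m → Fin k) i j → Dec (ColoursMeet c i j)
  coloursMeet? c i j = any? λ x → any? λ y → Adj? H x y ×-dec c x ≟ i ×-dec c y ≟ j

  ColoursMeet-sym : ∀ {k} {c : Fin m → Fin k} {i j} → ColoursMeet c i j → ColoursMeet c j i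
  ColoursMeet-sym (x , y , xy , cx , cy) = y , x , Adj-sym H xy , cy , cx

  proper⇒properComplete : ∀ j (c : Fin m → Fin j) → Surjective c → Proper H c →
                          ∃ (HasProperCompleteColoring H)
  proper⇒properComplete zero c surj proper = zero , c , surj , proper , λ ()
  proper⇒properComplete (suc j) c surj proper
    with any? (λ i → any? λ i′ → ¬? (i ≟ i′) ×-dec ¬? (coloursMeet? c i i′))
  ... | no noGap = suc j , c , surj , proper , complete
    where
    complete : Complete H c
    complete i i′ i≢i′ =
      decidable-stable (coloursMeet? c i i′) λ ¬meet → noGap (i , i′ , i≢i′ , ¬meet)
  ... | yes (i , i′ , i≢i′ , ¬meet) = proper⇒properComplete j c′ surj′ proper′
    where
    c′ : Fin m → Fin j
    c′ = merge (≢-sym i≢i′) ∘ c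

    surj′ : Surjective c′
    surj′ s = let x , cx = surj (punchIn i′ s) in
      x , trans (cong (merge (≢-sym i≢i′)) cx) (merge-punchIn (≢-sym i≢i′) s)

    proper′ : Proper H c′
    proper′ x y xy same with merge-≡ (≢-sym i≢i′) same
    ... | inj₁ cx≡cy            = proper x y xy cx≡cy
    ... | inj₂ (inj₁ (cx , cy)) = ¬meet (ColoursMeet-sym (x , y , xy , cx , cy))
    ... | inj₂ (inj₂ (cx , cy)) = ¬meet (x , y , xy , cx , cy)

  properComplete-exists : ∃ (HasProperCompleteColoring H)
  properComplete-exists = proper⇒properComplete m id (λ x → x , refl) (λ x y → Adj⇒≢ H)

-- Graphs without induced P₄, C₄, P₃ ∪ K₂ and 3K₂

-- All pairs of pattern vertices are listed in the order of `pairs` below; distinctness is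
-- only assumed for non-adjacent twins, the ends of the P₃ and the diagonals of the C₄.
module _ {n} (G : Graph n) where

  P₄-free : Set
  P₄-free = ∀ a b c d →
    Adj G a b → ¬ Adj G a c → ¬ Adj G a d → Adj G b c → ¬ Adj G b d → Adj G c d → ⊥

  C₄-free : Set
  C₄-free = ∀ a b c d → a ≢ c → b ≢ d →
    Adj G a b → ¬ Adj G a c → Adj G a d → Adj G b c → ¬ Adj G b d → Adj G c d → ⊥

  P₃∪K₂-free : Set
  P₃∪K₂-free = ∀ a b c d e → a ≢ c →
    Adj G a b → ¬ Adj G a c → ¬ Adj G a d → ¬ Adj G a e →
    Adj G b c → ¬ Adj G b d → ¬ Adj G b e →
    ¬ Adj G c d → ¬ Adj G c e →
    Adj G d e → ⊥

  3K₂-free : Set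
  3K₂-free = ∀ a b c d e f →
    Adj G a b → ¬ Adj G a c → ¬ Adj G a d → ¬ Adj G a e → ¬ Adj G a f →
    ¬ Adj G b c → ¬ Adj G b d → ¬ Adj G b e → ¬ Adj G b f →
    Adj G c d → ¬ Adj G c e → ¬ Adj G c f →
    ¬ Adj G d e → ¬ Adj G d f →
    Adj G e f → ⊥

record ObstructionFree {n} (G : Graph n) : Set where
  field
    no-P₄    : P₄-free G
    no-C₄    : C₄-free G
    no-P₃∪K₂ : P₃∪K₂-free G
    no-3K₂   : 3K₂-free G
open ObstructionFree

ObstructionFree-induced : ∀ {m n} (G : Graph n) (f : Fin m → Fin n) → Injective _≡_ _≡_ f →
                          ObstructionFree G → ObstructionFree (induced G f)
ObstructionFree-induced G f f-inj free = record
  { no-P₄    = λ a b c d → no-P₄ free (f a) (f b) (f c) (f d)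
  ; no-C₄    = λ a b c d a≢c b≢d → no-C₄ free (f a) (f b) (f c) (f d) (a≢c ∘ f-inj) (b≢d ∘ f-inj)
  ; no-P₃∪K₂ = λ a b c d e a≢c → no-P₃∪K₂ free (f a) (f b) (f c) (f d) (f e) (a≢c ∘ f-inj)
  ; no-3K₂   = λ a b c d e g → no-3K₂ free (f a) (f b) (f c) (f d) (f e) (f g)
  }

module _ {m} {P : Fin m → Set} (P? : ∀ x → Dec (P x)) where

  select : Subset m
  select = tabulate (does ∘ P?)

  ∈-select⁺ : ∀ {x} → P x → x Subset.∈ select
  ∈-select⁺ {x} px = lookup⇒[]= x select (trans (lookup∘tabulate _ x) (dec-true (P? x) px))

  ∈-select⁻ : ∀ {x} → x Subset.∈ select → P x
  ∈-select⁻ {x} x∈ = decidable-stable (P? x) λ ¬px →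
    contradiction (trans (≡.sym ([]=⇒lookup x∈)) (trans (lookup∘tabulate _ x) (dec-false (P? x) ¬px))) λ ()

⊂-maximal : ∀ {m n} (N : Fin m → Subset n) → Fin m → ∃ λ v → ∀ x → ¬ N v ⊂ N x
⊂-maximal N v₀ = go v₀ (⊃-wellFounded (N v₀))
  where
  go : ∀ v → Acc _⊃_ (N v) → ∃ λ v → ∀ x → ¬ N v ⊂ N x
  go v (acc larger) with any? (λ x → N v ⊂? N x)
  ... | yes (x , v⊂x) = go x (larger v⊂x)
  ... | no ∄x         = v , λ x v⊂x → ∄x (x , v⊂x)

module _ {m} (H : Graph m) where

  IsUniversal : Fin m → Set
  IsUniversal u = ∀ x → x ≢ u → Adj H u x

  universal? : ∀ u → Dec (IsUniversal u)
  universal? u = all? λ x → ¬? (x ≟ u) →-dec Adj? H u x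

  non-neighbour : ∀ {u} → ¬ IsUniversal u → ∃ λ x → x ≢ u × ¬ Adj H u x
  non-neighbour {u} ¬univ with ¬∀⟶∃¬ _ _ (λ x → ¬? (x ≟ u) →-dec Adj? H u x) ¬univ
  ... | x , ¬imp = x , (λ x≡u → ¬imp λ x≢u → contradiction x≡u x≢u) , λ ux → ¬imp λ _ → ux

  IsIsolated : Fin m → Set
  IsIsolated v = ∀ x → ¬ Adj H v x

  isolated? : ∀ v → Dec (IsIsolated v)
  isolated? v = all? λ x → ¬? (Adj? H v x)

  neighbour : ∀ {v} → ¬ IsIsolated v → ∃ (Adj H v)
  neighbour {v} ¬iso with ¬∀⟶∃¬ _ _ (λ x → ¬? (Adj? H v x)) ¬iso
  ... | x , ¬¬vx = x , decidable-stable (Adj? H v x) ¬¬vx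

  clique-from-induced : ∀ {k l} (f : Fin l → Fin m) → Injective _≡_ _≡_ f →
                        HasClique (induced H f) k → HasClique H k
  clique-from-induced f f-inj (q , q-inj , q-adj) = f ∘ q , q-inj ∘ f-inj , q-adj

  Occurs : ∀ {k} → (Fin m → Set) → (Fin m → Fin k) → Fin k → Set
  Occurs S c i = ∃ λ x → S x × c x ≡ i

  occurs? : ∀ {k} {S : Fin m → Set} → (∀ x → Dec (S x)) → (c : Fin m → Fin k) → ∀ i → Dec (Occurs S c i)
  occurs? S? c i = any? λ x → S? x ×-dec c x ≟ i

  rainbow-clique : ∀ {k} (S : Fin m → Set) → (∀ x y → S x → S y → x ≢ y → Adj H x y) →
                   (c : Fin m → Fin k) → (∀ i → Occurs S c i) → HasClique H k
  rainbow-clique {k} S S-clique c rainbow = q , q-inj , q-adj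
    where
    q : Fin k → Fin m
    q = proj₁ ∘ rainbow

    q-inj : Injective _≡_ _≡_ q
    q-inj {i} {j} qi≡qj =
      trans (≡.sym (proj₂ (proj₂ (rainbow i)))) (trans (cong c qi≡qj) (proj₂ (proj₂ (rainbow j))))

    q-adj : ∀ i j → i ≢ j → Adj H (q i) (q j)
    q-adj i j i≢j = S-clique (q i) (q j) (proj₁ (proj₂ (rainbow i))) (proj₁ (proj₂ (rainbow j))) (i≢j ∘ q-inj)

  -- A colour missing inside S and a colour missing outside S would have to meet across the cut.
  complete-on-one-side : ∀ {k} {S : Fin m → Set} → (∀ x → Dec (S x)) →
    (∀ x y → S x → ¬ S y → ¬ Adj H x y) →
    (c : Fin m → Fin k) → Surjective c → Complete H c →
    (∀ i → Occurs S c i) ⊎ (∀ i → Occurs (¬_ ∘ S) c i)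
  complete-on-one-side {S = S} S? separated c surj complete with any? (λ p → ¬? (occurs? S? c p))
  ... | no ∄p         = inj₁ λ i → decidable-stable (occurs? S? c i) λ ∄i → ∄p (i , ∄i)
  ... | yes (p , ∄in) = inj₂ λ q → decidable-stable (occurs? (¬? ∘ S?) c q) (missing q)
    where
    missing : ∀ q → ¬ Occurs (¬_ ∘ S) c q → ⊥
    missing q ∄out with p ≟ q
    ... | yes refl with surj p
    ...   | x , cx with S? x
    ...     | yes sx = ∄in (x , sx , cx)
    ...     | no ¬sx = ∄out (x , ¬sx , cx)
    missing q ∄out | no p≢q with complete p q p≢q
    ... | x , y , xy , cx , cy with S? x | S? y
    ...   | yes sx | _      = ∄in (x , sx , cx)
    ...   | no ¬sx | yes sy = separated y x sy ¬sx (Adj-sym H xy)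
    ...   | no _   | no ¬sy = ∄out (y , ¬sy , cy)

  InN[_] : Fin m → Fin m → Set
  InN[ v ] x = x ≡ v ⊎ Adj H v x

  inN[_]? : ∀ v x → Dec (InN[ v ] x)
  inN[ v ]? x = x ≟ v ⊎-dec Adj? H v x

  N[_] : Fin m → Subset m
  N[ v ] = select inN[ v ]?

  -- If y ∉ N[v], maximality gives z ∈ N[v] ∖ N[x], and z v x y is an induced P₄ or C₄.
  N[maximal]-closed : P₄-free H → C₄-free H → ∀ v → (∀ x → ¬ N[ v ] ⊂ N[ x ]) →
                      ∀ {x y} → Adj H v x → Adj H x y → InN[ v ] y
  N[maximal]-closed p₄ c₄ v maximal {x} {y} vx xy with inN[ v ]? y
  ... | yes y∈ = y∈
  ... | no y∉ with any? (λ z → inN[ v ]? z ×-dec ¬? (inN[ x ]? z))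
  ...   | no ∄z = ⊥-elim (maximal x (N[v]⊆N[x] , y , ∈-select⁺ inN[ x ]? (inj₂ xy) , y∉ ∘ ∈-select⁻ inN[ v ]?))
    where
    N[v]⊆N[x] : N[ v ] ⊆ N[ x ]
    N[v]⊆N[x] {z} z∈ = ∈-select⁺ inN[ x ]? (decidable-stable (inN[ x ]? z) λ z∉ →
                                              ∄z (z , ∈-select⁻ inN[ v ]? z∈ , z∉))
  ...   | yes (z , z∈v , z∉x) = ⊥-elim (P₄-or-C₄ z∈v)
    where
    P₄-or-C₄ : InN[ v ] z → ⊥
    P₄-or-C₄ (inj₁ refl) = z∉x (inj₂ (Adj-sym H vx))
    P₄-or-C₄ (inj₂ vz) with Adj? H z y
    ... | yes zy = c₄ z v x y (z∉x ∘ inj₁) (y∉ ∘ inj₁ ∘ ≡.sym)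
                     (Adj-sym H vz) (z∉x ∘ inj₂ ∘ Adj-sym H) zy vx (y∉ ∘ inj₂) xy
    ... | no ¬zy = p₄ z v x y (Adj-sym H vz) (z∉x ∘ inj₂ ∘ Adj-sym H) ¬zy vx (y∉ ∘ inj₂) xy

  -- N[v] and its complement are cliques with no edge between them.
  module _ (free : ObstructionFree H)
           (non-universal : ∀ u → ∃ λ x → x ≢ u × ¬ Adj H u x)
           (non-isolated : ∀ v → ∃ (Adj H v))
           (v : Fin m) (maximal : ∀ x → ¬ N[ v ] ⊂ N[ x ]) where

    private
      A : Fin m → Set
      A = InN[ v ]

      A-closed : ∀ {x y} → A x → Adj H x y → A y
      A-closed (inj₁ refl) vy = inj₂ vy
      A-closed (inj₂ vx)   xy = N[maximal]-closed (no-P₄ free) (no-C₄ free) v maximal vx xy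

      cut : ∀ x y → A x → ¬ A y → ¬ Adj H x y
      cut x y x∈ y∉ xy = y∉ (A-closed x∈ xy)

      cut′ : ∀ x y → ¬ A x → A y → ¬ Adj H x y
      cut′ x y x∉ y∈ = ¬Adj-sym H (cut y x y∈ x∉)

      outside-neighbour : ∀ {x} → ¬ A x → ∃ λ x′ → Adj H x x′ × ¬ A x′
      outside-neighbour {x} x∉ = let x′ , xx′ = non-isolated x in
        x′ , xx′ , λ x′∈ → x∉ (A-closed x′∈ (Adj-sym H xx′))

      v∈A : A v
      v∈A = inj₁ refl

      v′ : Fin m
      v′ = proj₁ (non-isolated v)

      vv′ : Adj H v v′
      vv′ = proj₂ (non-isolated v)

      v′∈A : A v′
      v′∈A = inj₂ vv′

      w : Fin m
      w = proj₁ (non-universal v)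

      w∉A : ¬ A w
      w∉A (inj₁ w≡v) = proj₁ (proj₂ (non-universal v)) w≡v
      w∉A (inj₂ vw)  = proj₂ (proj₂ (non-universal v)) vw

      w′ : Fin m
      w′ = proj₁ (outside-neighbour w∉A)

      ww′ : Adj H w w′
      ww′ = proj₁ (proj₂ (outside-neighbour w∉A))

      w′∉A : ¬ A w′
      w′∉A = proj₂ (proj₂ (outside-neighbour w∉A))

      A-clique : ∀ x y → A x → A y → x ≢ y → Adj H x y
      A-clique x y (inj₁ refl) (inj₁ refl) x≢y = contradiction refl x≢y
      A-clique x y (inj₁ refl) (inj₂ vy)   _   = vy
      A-clique x y (inj₂ vx)   (inj₁ refl) _   = Adj-sym H vx
      A-clique x y (inj₂ vx)   (inj₂ vy)   x≢y = decidable-stable (Adj? H x y) λ ¬xy →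
        no-P₃∪K₂ free x v y w w′ x≢y
          (Adj-sym H vx) ¬xy (cut x w (inj₂ vx) w∉A) (cut x w′ (inj₂ vx) w′∉A)
          vy (cut v w v∈A w∉A) (cut v w′ v∈A w′∉A)
          (cut y w (inj₂ vy) w∉A) (cut y w′ (inj₂ vy) w′∉A)
          ww′

      outside-P₃ : ∀ {a b c} → ¬ A a → ¬ A b → ¬ A c → a ≢ c →
                   Adj H a b → ¬ Adj H a c → Adj H b c → ⊥
      outside-P₃ {a} {b} {c} a∉ b∉ c∉ a≢c ab ¬ac bc =
        no-P₃∪K₂ free a b c v v′ a≢c
          ab ¬ac (cut′ a v a∉ v∈A) (cut′ a v′ a∉ v′∈A)
          bc (cut′ b v b∉ v∈A) (cut′ b v′ b∉ v′∈A)
          (cut′ c v c∉ v∈A) (cut′ c v′ c∉ v′∈A)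
          vv′

      B-clique : ∀ s t → ¬ A s → ¬ A t → s ≢ t → Adj H s t
      B-clique s t s∉ t∉ s≢t with outside-neighbour s∉ | outside-neighbour t∉
      ... | s′ , ss′ , s′∉ | t′ , tt′ , t′∉ = decidable-stable (Adj? H s t) λ ¬st →
        let ¬st′ : ¬ Adj H s t′
            ¬st′ st′ = outside-P₃ s∉ t′∉ t∉ s≢t st′ ¬st (Adj-sym H tt′)
            s≢t′ : s ≢ t′
            s≢t′ s≡t′ = ¬st (Adj-sym H (subst (Adj H t) (≡.sym s≡t′) tt′))
        in no-3K₂ free s s′ t t′ v v′
             ss′ ¬st ¬st′ (cut′ s v s∉ v∈A) (cut′ s v′ s∉ v′∈A)
             (λ s′t → outside-P₃ s∉ s′∉ t∉ s≢t ss′ ¬st s′t)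
             (λ s′t′ → outside-P₃ s∉ s′∉ t′∉ s≢t′ ss′ ¬st′ s′t′)
             (cut′ s′ v s′∉ v∈A) (cut′ s′ v′ s′∉ v′∈A)
             tt′ (cut′ t v t∉ v∈A) (cut′ t v′ t∉ v′∈A)
             (cut′ t′ v t′∉ v∈A) (cut′ t′ v′ t′∉ v′∈A)
             vv′

    complete⇒clique-split : ∀ {k} → HasCompleteColoring H k → HasClique H k
    complete⇒clique-split (c , surj , complete) with complete-on-one-side inN[ v ]? cut c surj complete
    ... | inj₁ inside  = rainbow-clique A A-clique c inside
    ... | inj₂ outside = rainbow-clique (¬_ ∘ A) B-clique c outside

module _ {m} (H : Graph (suc m)) where

  clique-add-universal : ∀ {k} u → IsUniversal H u →
                         HasClique (induced H (punchIn u)) k → HasClique H (suc k)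
  clique-add-universal {k} u universal (q , q-inj , q-adj) = q′ , q′-inj , q′-adj
    where
    q′ : Fin (suc k) → Fin (suc m)
    q′ = u Vector.∷ punchIn u ∘ q

    q′-inj : Injective _≡_ _≡_ q′
    q′-inj {zero}  {zero}  _  = refl
    q′-inj {zero}  {suc j} eq = contradiction (≡.sym eq) (punchInᵢ≢i u (q j))
    q′-inj {suc i} {zero}  eq = contradiction eq (punchInᵢ≢i u (q i))
    q′-inj {suc i} {suc j} eq = cong suc (q-inj (punchIn-injective u _ _ eq))

    q′-adj : ∀ i j → i ≢ j → Adj H (q′ i) (q′ j)
    q′-adj zero    zero    0≢0 = contradiction refl 0≢0
    q′-adj zero    (suc j) _   = universal _ (punchInᵢ≢i u (q j))
    q′-adj (suc i) zero    _   = Adj-sym H (universal _ (punchInᵢ≢i u (q i)))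
    q′-adj (suc i) (suc j) i≢j = q-adj i j (i≢j ∘ cong suc)

  -- The colour class of u is merged into another one.
  complete-delete : ∀ {j} u → HasCompleteColoring H (suc (suc j)) →
                    HasCompleteColoring (induced H (punchIn u)) (suc j)
  complete-delete {j} u (c , surj , complete) = recolour ∘ c ∘ punchIn u , surj′ , complete′
    where
    other≢cu : c u ≢ punchIn (c u) zero
    other≢cu = ≢-sym (punchInᵢ≢i (c u) zero)

    recolour : Fin (suc (suc j)) → Fin (suc j)
    recolour = merge other≢cu

    unlift : ∀ {x} s → c x ≡ punchIn (c u) s → ∃ λ x′ → punchIn u x′ ≡ x
    unlift s cx = punchOut u≢x , punchIn-punchOut u≢x
      where
      u≢x : u ≢ _
      u≢x refl = punchInᵢ≢i (c u) s (≡.sym cx)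

    recolour-c : ∀ {x} s → c x ≡ punchIn (c u) s → recolour (c x) ≡ s
    recolour-c s cx = trans (cong recolour cx) (merge-punchIn other≢cu s)

    surj′ : Surjective (recolour ∘ c ∘ punchIn u)
    surj′ s with surj (punchIn (c u) s)
    ... | x , cx with unlift s cx
    ...   | x′ , refl = x′ , recolour-c s cx

    complete′ : Complete (induced H (punchIn u)) (recolour ∘ c ∘ punchIn u)
    complete′ s t s≢t with complete (punchIn (c u) s) (punchIn (c u) t) (s≢t ∘ punchIn-injective _ s t)
    ... | x , y , xy , cx , cy with unlift s cx | unlift t cy
    ...   | x′ , refl | y′ , refl = x′ , y′ , xy , recolour-c s cx , recolour-c t cy

  -- With at least two colours every colour occurs on an edge, hence off an isolated vertex.
  complete-delete-isolated : ∀ {j} v → IsIsolated H v → HasCompleteColoring H (suc (suc j)) →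
                             HasCompleteColoring (induced H (punchIn v)) (suc (suc j))
  complete-delete-isolated v isolated (c , surj , complete) = c ∘ punchIn v , surj′ , complete′
    where
    unlift : ∀ {x y} → Adj H x y → ∃ λ x′ → punchIn v x′ ≡ x
    unlift xy = punchOut v≢x , punchIn-punchOut v≢x
      where
      v≢x : v ≢ _
      v≢x refl = isolated _ xy

    surj′ : Surjective (c ∘ punchIn v)
    surj′ s with complete s (punchIn s zero) (≢-sym (punchInᵢ≢i s zero))
    ... | x , _ , xy , cx , _ with unlift xy
    ...   | x′ , refl = x′ , cx

    complete′ : Complete (induced H (punchIn v)) (c ∘ punchIn v)
    complete′ s t s≢t with complete s t s≢t
    ... | x , y , xy , cx , cy with unlift xy | unlift (Adj-sym H xy)
    ...   | x′ , refl | y′ , refl = x′ , y′ , xy , cx , cy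

complete⇒clique : ∀ {m} (H : Graph m) → ObstructionFree H → ∀ {k} → HasCompleteColoring H k → HasClique H k
complete⇒clique H free {zero} _ = (λ ()) , (λ { {()} }) , λ ()
complete⇒clique H free {suc zero} (_ , surj , _) =
  (λ _ → proj₁ (surj zero)) , (λ { {zero} {zero} _ → refl }) , λ { zero zero 0≢0 → contradiction refl 0≢0 }
complete⇒clique {zero} H free {suc (suc j)} (_ , surj , _) with proj₁ (surj zero)
... | ()
complete⇒clique {suc m} H free {suc (suc j)} col with any? (universal? H) | any? (isolated? H)
... | yes (u , universal) | _ =
  clique-add-universal H u universal
    (complete⇒clique _ (ObstructionFree-induced H (punchIn u) (punchIn-injective u _ _) free)
      (complete-delete H u col))
... | no _ | yes (v , isolated) =
  clique-from-induced H (punchIn v) (punchIn-injective v _ _)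
    (complete⇒clique _ (ObstructionFree-induced H (punchIn v) (punchIn-injective v _ _) free)
      (complete-delete-isolated H v isolated col))
... | no ∄u | no ∄v with ⊂-maximal (N[_] H) zero
...   | v , maximal =
  complete⇒clique-split H free (λ u → non-neighbour H (λ univ → ∄u (u , univ)))
    (λ x → neighbour H (λ iso → ∄v (x , iso))) v maximal col

-- Exhaustive search on small graphs

ForAllMaps : ∀ {A : Set} r → (Vector A r → Set) → Set
ForAllMaps zero    P = P Vector.[]
ForAllMaps (suc r) P = ∀ a → ForAllMaps r (P ∘ (a Vector.∷_))

forAllMaps? : ∀ {A : Set} → (∀ {P : A → Set} → (∀ a → Dec (P a)) → Dec (∀ a → P a)) →
              ∀ r {P : Vector A r → Set} → (∀ v → Dec (P v)) → Dec (ForAllMaps r P)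
forAllMaps? ∀? zero    P? = P? Vector.[]
forAllMaps? ∀? (suc r) P? = ∀? λ a → forAllMaps? ∀? r (P? ∘ (a Vector.∷_))

ForAllMaps-sound : ∀ {A : Set} r {P : Vector A r → Set} → (∀ {v w} → v ≗ w → P v → P w) →
                   ForAllMaps r P → ∀ v → P v
ForAllMaps-sound zero    resp all v = resp (λ ()) all
ForAllMaps-sound (suc r) resp all v =
  resp (λ { zero → refl ; (suc _) → refl })
       (ForAllMaps-sound r (λ v≗w → resp λ { zero → refl ; (suc i) → v≗w i }) (all (head v)) (tail v))

∀-Maybe? : ∀ {k} {P : Maybe (Fin k) → Set} → (∀ a → Dec (P a)) → Dec (∀ a → P a)
∀-Maybe? P? = map′ (λ (pn , pj) → λ { nothing → pn ; (just i) → pj i }) (λ p → p nothing , p ∘ just)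
                   (P? nothing ×-dec all? (P? ∘ just))

module _ {n} {G : Graph n} {P : Fin n → Set} where

  path-head : ∀ {x y} → PathIn G P x y → P x
  path-head (here px)     = px
  path-head (step px _ _) = px

  first-step : ∀ {x y} → PathIn G P x y → x ≢ y → ∃ λ z → Adj G x z × P z
  first-step (here _)          x≢x = contradiction refl x≢x
  first-step (step _ xz rest) _   = _ , xz , path-head rest

truncate : ∀ m {k} → Maybe (Fin (m + k)) → Maybe (Fin m)
truncate m nothing  = nothing
truncate m (just x) = [ just , const nothing ]′ (splitAt m x)

truncate-↑ˡ : ∀ m {k} (i : Fin m) → truncate m (just (i ↑ˡ k)) ≡ just i
truncate-↑ˡ m {k} i = cong [ just , const nothing ]′ (splitAt-↑ˡ m i k)

truncate-just : ∀ m {k} {a i} → truncate m {k} a ≡ just i → a ≡ just (i ↑ˡ k)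
truncate-just m {a = just x} eq with splitAt m x in split
truncate-just m {a = just x} refl | inj₁ i = cong just (≡.sym (splitAt⁻¹-↑ˡ split))

-- A labelling ℓ keeps three branch sets (or colour classes) of a minor (or colouring) of
-- order at least 3, with nothing on the other vertices.  Connectedness of branch sets is
-- weakened to NoLoneVertex, so that all 4ʳ labellings can be checked by evaluation.
module _ {r} (Gc : Graph r) where

  Linked : ∀ {k} → (Fin r → Maybe (Fin k)) → Set
  Linked ℓ = ∀ i j → i ≢ j → ∃[ x ] (ℓ x ≡ just i × ∃[ y ] (ℓ y ≡ just j × Adj Gc x y))

  NoLoneVertex : ∀ {k} → (Fin r → Maybe (Fin k)) → Set
  NoLoneVertex ℓ = ∀ i x → ℓ x ≡ just i → ∀ y → ℓ y ≡ just i → x ≢ y → ∃[ z ] (ℓ z ≡ just i × Adj Gc x z)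

  Independent : ∀ {k} → (Fin r → Maybe (Fin k)) → Set
  Independent ℓ = ∀ i x → ℓ x ≡ just i → ∀ y → ℓ y ≡ just i → ¬ Adj Gc x y

  private
    _≟ℓ_ : ∀ {k} (a b : Maybe (Fin k)) → Dec (a ≡ b)
    _≟ℓ_ = ≡-dec-Maybe _≟_

  linked? : ∀ {k} (ℓ : Fin r → Maybe (Fin k)) → Dec (Linked ℓ)
  linked? ℓ = all? λ i → all? λ j → ¬? (i ≟ j) →-dec
    any? λ x → ℓ x ≟ℓ just i ×-dec any? λ y → ℓ y ≟ℓ just j ×-dec Adj? Gc x y

  noLoneVertex? : ∀ {k} (ℓ : Fin r → Maybe (Fin k)) → Dec (NoLoneVertex ℓ)
  noLoneVertex? ℓ = all? λ i → all? λ x → ℓ x ≟ℓ just i →-dec all? λ y → ℓ y ≟ℓ just i →-dec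
    ¬? (x ≟ y) →-dec any? λ z → ℓ z ≟ℓ just i ×-dec Adj? Gc x z

  independent? : ∀ {k} (ℓ : Fin r → Maybe (Fin k)) → Dec (Independent ℓ)
  independent? ℓ = all? λ i → all? λ x → ℓ x ≟ℓ just i →-dec all? λ y → ℓ y ≟ℓ just i →-dec ¬? (Adj? Gc x y)

  MinorSketch : ∀ {k} → (Fin r → Maybe (Fin k)) → Set
  MinorSketch ℓ = Linked ℓ × NoLoneVertex ℓ

  ColouringSketch : ∀ {k} → (Fin r → Maybe (Fin k)) → Set
  ColouringSketch ℓ = Linked ℓ × Independent ℓ

  private
    module _ {k} {ℓ ℓ′ : Fin r → Maybe (Fin k)} (ℓ≗ℓ′ : ℓ ≗ ℓ′) where
      move : ∀ {x i} → ℓ x ≡ i → ℓ′ x ≡ i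
      move {x} = trans (≡.sym (ℓ≗ℓ′ x))

      Linked-resp : Linked ℓ → Linked ℓ′
      Linked-resp linked i j i≢j = let x , ℓx , y , ℓy , xy = linked i j i≢j in x , move ℓx , y , move ℓy , xy

      NoLoneVertex-resp : NoLoneVertex ℓ → NoLoneVertex ℓ′
      NoLoneVertex-resp noLone i x ℓx y ℓy x≢y =
        let z , ℓz , xz = noLone i x (trans (ℓ≗ℓ′ x) ℓx) y (trans (ℓ≗ℓ′ y) ℓy) x≢y in z , move ℓz , xz

      Independent-resp : Independent ℓ → Independent ℓ′
      Independent-resp indep i x ℓx y ℓy = indep i x (trans (ℓ≗ℓ′ x) ℓx) y (trans (ℓ≗ℓ′ y) ℓy)

    ¬-resp : ∀ {k} {Q : (Fin r → Maybe (Fin k)) → Set} → (∀ {ℓ ℓ′} → ℓ ≗ ℓ′ → Q ℓ → Q ℓ′) →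
             ∀ {ℓ ℓ′} → ℓ ≗ ℓ′ → ¬ Q ℓ → ¬ Q ℓ′
    ¬-resp resp ℓ≗ℓ′ ¬q q = ¬q (resp (≡.sym ∘ ℓ≗ℓ′) q)

  minor⇒sketch : ∀ {k} → HasCompleteMinor Gc (3 + k) → ∃ MinorSketch
  minor⇒sketch {k} (branch , _ , connected , linked) = ℓ , linked′ , noLone
    where
    ℓ : Fin r → Maybe (Fin 3)
    ℓ = truncate 3 ∘ branch

    linked′ : Linked ℓ
    linked′ i j i≢j = let x , y , xy , bx , by = linked (i ↑ˡ k) (j ↑ˡ k) (i≢j ∘ ↑ˡ-injective k i j) in
      x , trans (cong (truncate 3) bx) (truncate-↑ˡ 3 i) ,
      y , trans (cong (truncate 3) by) (truncate-↑ˡ 3 j) , xy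

    noLone : NoLoneVertex ℓ
    noLone i x ℓx y ℓy x≢y =
      let z , xz , bz = first-step (connected (i ↑ˡ k) x y (truncate-just 3 ℓx) (truncate-just 3 ℓy)) x≢y in
      z , trans (cong (truncate 3) bz) (truncate-↑ˡ 3 i) , xz

  properComplete⇒sketch : ∀ {k} → HasProperCompleteColoring Gc (3 + k) → ∃ ColouringSketch
  properComplete⇒sketch {k} (c , _ , proper , complete) = ℓ , linked , independent
    where
    ℓ : Fin r → Maybe (Fin 3)
    ℓ = truncate 3 ∘ just ∘ c

    linked : Linked ℓ
    linked i j i≢j = let x , y , xy , cx , cy = complete (i ↑ˡ k) (j ↑ˡ k) (i≢j ∘ ↑ˡ-injective k i j) in
      x , trans (cong (truncate 3 ∘ just) cx) (truncate-↑ˡ 3 i) ,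
      y , trans (cong (truncate 3 ∘ just) cy) (truncate-↑ˡ 3 j) , xy

    independent : Independent ℓ
    independent i x ℓx y ℓy xy =
      proper x y xy (just-injective (trans (truncate-just 3 ℓx) (≡.sym (truncate-just 3 ℓy))))

  no-K₃₊-minor : ForAllMaps r (¬_ ∘ MinorSketch) → ∀ {k} → ¬ HasCompleteMinor Gc (3 + k)
  no-K₃₊-minor none minor =
    let ℓ , sketch = minor⇒sketch minor in
    ForAllMaps-sound r (¬-resp λ ℓ≗ℓ′ (l , n) → Linked-resp ℓ≗ℓ′ l , NoLoneVertex-resp ℓ≗ℓ′ n) none ℓ sketch

  no-properComplete-3₊ : ForAllMaps r (¬_ ∘ ColouringSketch) → ∀ {k} → ¬ HasProperCompleteColoring Gc (3 + k)
  no-properComplete-3₊ none colouring =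
    let ℓ , sketch = properComplete⇒sketch colouring in
    ForAllMaps-sound r (¬-resp λ ℓ≗ℓ′ (l , i) → Linked-resp ℓ≗ℓ′ l , Independent-resp ℓ≗ℓ′ i) none ℓ sketch

  minorSketch? : (ℓ : Fin r → Maybe (Fin 3)) → Dec (MinorSketch ℓ)
  minorSketch? ℓ = linked? ℓ ×-dec noLoneVertex? ℓ

  colouringSketch? : (ℓ : Fin r → Maybe (Fin 3)) → Dec (ColouringSketch ℓ)
  colouringSketch? ℓ = linked? ℓ ×-dec independent? ℓ

-- The four obstructions

module _ {r : ℕ} where
  open DecMembership (×-≡-dec (_≟_ {r}) (_≟_ {r})) using (_∈?_; _∉?_)

  Twins : Graph r → Fin r → Fin r → Set
  Twins Gc i j = ∀ k → adj Gc i k ≡ adj Gc j k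

  TwinsAmong : Graph r → List (Fin r × Fin r) → Set
  TwinsAmong Gc ps = ∀ i j → Twins Gc i j → i ≡ j ⊎ (i , j) ∈ ps ⊎ (j , i) ∈ ps

  twinsAmong? : ∀ Gc ps → Dec (TwinsAmong Gc ps)
  twinsAmong? Gc ps = all? λ i → all? λ j → (all? λ k → adj Gc i k Bool.≟ adj Gc j k) →-dec
    (i ≟ j ⊎-dec (i , j) ∈? ps ⊎-dec (j , i) ∈? ps)

  fromEdges : (es : List (Fin r × Fin r)) → {True (all? λ x → (x , x) ∉? es)} → Graph r
  fromEdges es {loopless} = record
    { adj    = λ x y → does ((x , y) ∈? es) ∨ does ((y , x) ∈? es)
    ; sym    = λ x y → ∨-comm (does ((x , y) ∈? es)) (does ((y , x) ∈? es))
    ; irrefl = λ x → cong (λ b → b ∨ b) (dec-false ((x , x) ∈? es) (toWitness loopless x))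
    }

P₄ : Graph 4
P₄ = fromEdges ((# 0 , # 1) ∷ (# 1 , # 2) ∷ (# 2 , # 3) ∷ [])

C₄ : Graph 4
C₄ = fromEdges ((# 0 , # 1) ∷ (# 1 , # 2) ∷ (# 2 , # 3) ∷ (# 3 , # 0) ∷ [])

P₃∪K₂ : Graph 5
P₃∪K₂ = fromEdges ((# 0 , # 1) ∷ (# 1 , # 2) ∷ (# 3 , # 4) ∷ [])

3K₂ : Graph 6
3K₂ = fromEdges ((# 0 , # 1) ∷ (# 2 , # 3) ∷ (# 4 , # 5) ∷ [])


module _ {r k} (Gc : Graph r) (c : Fin r → Fin k) where

  surjective? : Dec (Surjective c)
  surjective? = all? λ i → any? λ x → c x ≟ i

  proper? : Dec (Proper Gc c)
  proper? = all? λ x → all? λ y → Adj? Gc x y →-dec ¬? (c x ≟ c y)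

  complete? : Dec (Complete Gc c)
  complete? = all? λ i → all? λ j → ¬? (i ≟ j) →-dec coloursMeet? Gc c i j

  properComplete? : Dec (Surjective c × Proper Gc c × Complete Gc c)
  properComplete? = surjective? ×-dec proper? ×-dec complete?

  ClassesAreCliques : Set
  ClassesAreCliques = ∀ x y → c x ≡ c y → x ≡ y ⊎ Adj Gc x y

  classesAreCliques? : Dec ClassesAreCliques
  classesAreCliques? = all? λ x → all? λ y → c x ≟ c y →-dec (x ≟ y ⊎-dec Adj? Gc x y)

  complete⇒minor : Surjective c → Complete Gc c → ClassesAreCliques → HasCompleteMinor Gc k
  complete⇒minor surj complete cliques = just ∘ c , (λ i → map₂ (cong just) (surj i)) , connected , linked
    where
    connected : ∀ i x y → just (c x) ≡ just i → just (c y) ≡ just i → PathIn Gc (λ z → just (c z) ≡ just i) x y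
    connected i x y cx cy with cliques x y (just-injective (trans cx (≡.sym cy)))
    ... | inj₁ refl = here cx
    ... | inj₂ xy   = step cx xy (here cy)

    linked : ∀ i j → i ≢ j → ∃[ x ] ∃[ y ] (Adj Gc x y × just (c x) ≡ just i × just (c y) ≡ just j)
    linked i j i≢j = let x , y , xy , cx , cy = complete i j i≢j in x , y , xy , cong just cx , cong just cy

pairs : ∀ r → List (Fin r × Fin r)
pairs zero    = []
pairs (suc r) = List.map (zero ,_) (List.map suc (allFin r)) ++ List.map (Product.map suc suc) (pairs r)

∈-pairs : ∀ {r} {i j : Fin r} → i < j → (i , j) ∈ pairs r
∈-pairs {i = zero}  {zero}  ()
∈-pairs {i = suc _} {zero}  ()
∈-pairs {i = zero}  {suc j} _         = ∈-++⁺ˡ (∈-map⁺ (zero ,_) (∈-map⁺ suc (∈-allFin j)))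
∈-pairs {i = suc _} {suc _} (s≤s i<j) = ∈-++⁺ʳ _ (∈-map⁺ (Product.map suc suc) (∈-pairs i<j))

module _ {n} (G : Graph n) where

  AdjIs : Bool → Fin n → Fin n → Set
  AdjIs true  x y = Adj G x y
  AdjIs false x y = ¬ Adj G x y

  AdjIs⇒≡ : ∀ b {x y} → AdjIs b x y → adj G x y ≡ b
  AdjIs⇒≡ true  xy  = xy
  AdjIs⇒≡ false ¬xy = ¬-not ¬xy

InducedCopy : ∀ {r n} → Graph r → Graph n → Set
InducedCopy {r} {n} Gc G = Σ (Fin r → Fin n) λ g → Injective _≡_ _≡_ g × SameAdj (induced G g) Gc

module _ {r n} (Gc : Graph r) (G : Graph n) (vs : Vec (Fin n) r) where

  PatternAdj : Set
  PatternAdj = All (uncurry λ i j → AdjIs G (adj Gc i j) (lookup vs i) (lookup vs j)) (pairs r)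

  Separated : List (Fin r × Fin r) → Set
  Separated = All (uncurry λ i j → lookup vs i ≢ lookup vs j)

  -- A map inducing Gc can only identify twins of Gc, so distinctness is needed just for those.
  inducedCopy : PatternAdj → ∀ {ps} → TwinsAmong Gc ps → Separated ps → InducedCopy Gc G
  inducedCopy facts twins separated = g , g-inj , same
    where
    g : Fin r → Fin n
    g = lookup vs

    same : SameAdj (induced G g) Gc
    same i j with <-cmp i j
    ... | tri< i<j _ _  = AdjIs⇒≡ G (adj Gc i j) (All.lookup facts (∈-pairs i<j))
    ... | tri≈ _ refl _ = trans (irrefl G (g i)) (≡.sym (irrefl Gc i))
    ... | tri> _ _ j<i  =
      trans (sym G (g i) (g j)) (trans (AdjIs⇒≡ G (adj Gc j i) (All.lookup facts (∈-pairs j<i))) (sym Gc j i))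

    g-inj : Injective _≡_ _≡_ g
    g-inj {i} {j} gi≡gj
      with twins i j (λ k → trans (≡.sym (same i k)) (trans (cong (λ x → adj G x (g k)) gi≡gj) (same j k)))
    ... | inj₁ i≡j        = i≡j
    ... | inj₂ (inj₁ ij∈) = contradiction gi≡gj (All.lookup separated ij∈)
    ... | inj₂ (inj₂ ji∈) = contradiction (≡.sym gi≡gj) (All.lookup separated ji∈)

αh-Equal : ∀ {r} → Graph r → Set
αh-Equal Gc = SameValue (HasProperCompleteColoring Gc) (HasCompleteMinor Gc)

αh-Perfect⇒αh-Equal : ∀ {r n} {Gc : Graph r} (G : Graph n) → αh-Perfect G → InducedCopy Gc G → αh-Equal Gc
αh-Perfect⇒αh-Equal {Gc = Gc} G perfect (g , g-inj , same) =
  let k , (α , α-max) , (h , h-max) = perfect _ g g-inj in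
  k , (To.properComplete α , λ j → α-max j ∘ From.properComplete) , (To.minor h , λ j → h-max j ∘ From.minor)
  where
  module To   = Transport (induced G g) Gc same
  module From = Transport Gc (induced G g) (λ x y → ≡.sym (same x y))

module _ {r} {Gc : Graph r} where

  α≥3>h⇒¬αh-Equal : HasProperCompleteColoring Gc 3 → (∀ {k} → ¬ HasCompleteMinor Gc (3 + k)) → ¬ αh-Equal Gc
  α≥3>h⇒¬αh-Equal colouring no-minor (k , (_ , α-max) , (h , _)) with m≤n⇒∃[o]m+o≡n (α-max 3 colouring)
  ... | _ , refl = no-minor h

  h≥3>α⇒¬αh-Equal : HasCompleteMinor Gc 3 → (∀ {k} → ¬ HasProperCompleteColoring Gc (3 + k)) → ¬ αh-Equal Gc
  h≥3>α⇒¬αh-Equal minor no-colouring (k , (α , _) , (_ , h-max)) with m≤n⇒∃[o]m+o≡n (h-max 3 minor)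
  ... | _ , refl = no-colouring α

P₄-not-αh-Equal : ¬ αh-Equal P₄
P₄-not-αh-Equal = α≥3>h⇒¬αh-Equal (c , from-yes (properComplete? P₄ c))
  (no-K₃₊-minor P₄ (from-yes (forAllMaps? ∀-Maybe? 4 (¬? ∘ minorSketch? P₄))))
  where
  c : Fin 4 → Fin 3
  c = lookup (# 0 ∷ # 1 ∷ # 2 ∷ # 0 ∷ [])

C₄-not-αh-Equal : ¬ αh-Equal C₄
C₄-not-αh-Equal = h≥3>α⇒¬αh-Equal
  (complete⇒minor C₄ c (from-yes (surjective? C₄ c)) (from-yes (complete? C₄ c))
                       (from-yes (classesAreCliques? C₄ c)))
  (no-properComplete-3₊ C₄ (from-yes (forAllMaps? ∀-Maybe? 4 (¬? ∘ colouringSketch? C₄))))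
  where
  c : Fin 4 → Fin 3
  c = lookup (# 0 ∷ # 1 ∷ # 2 ∷ # 2 ∷ [])

P₃∪K₂-not-αh-Equal : ¬ αh-Equal P₃∪K₂
P₃∪K₂-not-αh-Equal = α≥3>h⇒¬αh-Equal (c , from-yes (properComplete? P₃∪K₂ c))
  (no-K₃₊-minor P₃∪K₂ (from-yes (forAllMaps? ∀-Maybe? 5 (¬? ∘ minorSketch? P₃∪K₂))))
  where
  c : Fin 5 → Fin 3
  c = lookup (# 1 ∷ # 0 ∷ # 2 ∷ # 1 ∷ # 2 ∷ [])

3K₂-not-αh-Equal : ¬ αh-Equal 3K₂
3K₂-not-αh-Equal = α≥3>h⇒¬αh-Equal (c , from-yes (properComplete? 3K₂ c))
  (no-K₃₊-minor 3K₂ (from-yes (forAllMaps? ∀-Maybe? 6 (¬? ∘ minorSketch? 3K₂))))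
  where
  c : Fin 6 → Fin 3
  c = lookup (# 0 ∷ # 1 ∷ # 1 ∷ # 2 ∷ # 2 ∷ # 0 ∷ [])

αh-Perfect⇒ObstructionFree : ∀ {n} (G : Graph n) → αh-Perfect G → ObstructionFree G
αh-Perfect⇒ObstructionFree {n} G perfect = record
  { no-P₄ = λ a b c d ab ac ad bc bd cd →
      P₄-not-αh-Equal (copy P₄ (a ∷ b ∷ c ∷ d ∷ []) (ab ∷ ac ∷ ad ∷ bc ∷ bd ∷ cd ∷ [])
        (from-yes (twinsAmong? P₄ [])) [])
  ; no-C₄ = λ a b c d a≢c b≢d ab ac ad bc bd cd →
      C₄-not-αh-Equal (copy C₄ (a ∷ b ∷ c ∷ d ∷ []) (ab ∷ ac ∷ ad ∷ bc ∷ bd ∷ cd ∷ [])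
        (from-yes (twinsAmong? C₄ ((# 0 , # 2) ∷ (# 1 , # 3) ∷ []))) (a≢c ∷ b≢d ∷ []))
  ; no-P₃∪K₂ = λ a b c d e a≢c ab ac ad ae bc bd be cd ce de →
      P₃∪K₂-not-αh-Equal (copy P₃∪K₂ (a ∷ b ∷ c ∷ d ∷ e ∷ []) (ab ∷ ac ∷ ad ∷ ae ∷ bc ∷ bd ∷ be ∷ cd ∷ ce ∷ de ∷ [])
        (from-yes (twinsAmong? P₃∪K₂ ((# 0 , # 2) ∷ []))) (a≢c ∷ []))
  ; no-3K₂ = λ a b c d e f ab ac ad ae af bc bd be bf cd ce cf de df ef →
      3K₂-not-αh-Equal (copy 3K₂ (a ∷ b ∷ c ∷ d ∷ e ∷ f ∷ [])
        (ab ∷ ac ∷ ad ∷ ae ∷ af ∷ bc ∷ bd ∷ be ∷ bf ∷ cd ∷ ce ∷ cf ∷ de ∷ df ∷ ef ∷ [])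
        (from-yes (twinsAmong? 3K₂ [])) [])
  }
  where
  copy : ∀ {r} (Gc : Graph r) (vs : Vec (Fin n) r) → PatternAdj Gc G vs →
         ∀ {ps} → TwinsAmong Gc ps → Separated Gc G vs ps → αh-Equal Gc
  copy Gc vs facts twins separated = αh-Perfect⇒αh-Equal G perfect (inducedCopy Gc G vs facts twins separated)

αh-Perfect⇒ωψ-Perfect : ∀ {n} (G : Graph n) → αh-Perfect G → ωψ-Perfect G
αh-Perfect⇒ωψ-Perfect G perfect m f f-inj with perfect m f f-inj
... | k , (achromatic , _) , (_ , h-max) =
  k , (complete⇒clique H free (properComplete⇒complete H achromatic) , λ j → h-max j ∘ clique⇒minor H) ,
      (properComplete⇒complete H achromatic , λ j → h-max j ∘ clique⇒minor H ∘ complete⇒clique H free)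
  where
  H : Graph m
  H = induced G f

  free : ObstructionFree H
  free = ObstructionFree-induced G f f-inj (αh-Perfect⇒ObstructionFree G perfect)

ωψ-Perfect⇒αh-Perfect : ∀ {n} (G : Graph n) → ωψ-Perfect G → αh-Perfect G
ωψ-Perfect⇒αh-Perfect G perfect m f f-inj with perfect m f f-inj
... | k , (clique , _) , (_ , ψ-max) =
  k , (achromatic , λ j → ψ-max j ∘ properComplete⇒complete H) , (clique⇒minor H clique , hadwiger≤k)
  where
  H : Graph m
  H = induced G f

  achromatic : HasProperCompleteColoring H k
  achromatic with properComplete-exists H
  ... | j , colouring@(c , _ , proper , _) =
    subst (HasProperCompleteColoring H)
          (≤-antisym (ψ-max j (properComplete⇒complete H colouring)) (clique≤colours H clique c proper))
          colouring

  hadwiger≤k : ∀ j → HasCompleteMinor H j → j ≤ k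
  hadwiger≤k zero    _     = z≤n
  hadwiger≤k (suc j) minor = ψ-max (suc j) (minor⇒complete H minor)

corollary2 : ∀ {n : ℕ} (G : Graph n) → αh-Perfect G ⇔ ωψ-Perfect G
corollary2 G = mk⇔ (αh-Perfect⇒ωψ-Perfect G) (ωψ-Perfect⇒αh-Perfect G)
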